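{- For every integer $n\ge0$, the total number of inversions over all involutions of $[n]$ is $$i_n^{(1)}=\binom{n}{2}r_{n-2}^{(1)}+2\binom{n}{3}r_{n-3}^{(1)}+6\binom{n}{4}r_{n-4}^{(1)}.$$
   Context: An involution of $[n]$ is a permutation $\pi$ of $[n]$ with $\pi\circ\pi=\mathrm{id}$. $r_m^{(1)}$ is the number of involutions of $[m]$ for $m\ge0$ ($r_0^{(1)}=1$), with $r_m^{(1)}=0$ for $m<0$. For a permutation $\pi$, $\mathrm{inv}(\pi)=|\{(i,j):i<j,\ \pi_i>\pi_j\}|$, and $i_n^{(1)}=\sum\mathrm{inv}(\pi)$ over all involutions $\pi$ of $[n]$. -}

module Defs where

open import Data.Nat using (ℕ; zero; suc)
open import Data.Fin using (Fin; toℕ; _<?_; _≟_)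
open import Data.Fin.Properties using (all?)
open import Data.List using (List; []; _∷_; map; concatMap; filter; length; allFin)
open import Data.Nat.ListAction using (sum)
open import Data.Product using (_×_; _,_)
open import Relation.Binary.PropositionalEquality using (_≡_)
open import Relation.Nullary using (Dec; yes; no)
open import Relation.Nullary.Decidable using (_×-dec_)

-- A map π : [n] → [n] (elements of [n] represented by Fin n).
-- An involution is a π with π ∘ π = id (this forces π to be a permutation).
IsInvolution : ∀ {n} → (Fin n → Fin n) → Set
IsInvolution {n} π = ∀ (i : Fin n) → π (π i) ≡ i

isInvolution? : ∀ {n} (π : Fin n → Fin n) → Dec (IsInvolution π)
isInvolution? π = all? (λ i → π (π i) ≟ i)

allFuns : (m n : ℕ) → List (Fin m → Fin n)
allFuns zero    n = (λ ()) ∷ []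
allFuns (suc m) n =
  concatMap (λ f → map (λ (j : Fin n) → λ where
                                         Fin.zero → j
                                         (Fin.suc i) → f i) (allFin n))
            (allFuns m n)

involutions : (n : ℕ) → List (Fin n → Fin n)
involutions n = filter isInvolution? (allFuns n n)

r1 : ℕ → ℕ
r1 m = length (involutions m)

-- r_{n-k}^{(1)}, with the convention r_m^{(1)} = 0 for m < 0.
r1-sub : ℕ → ℕ → ℕ
r1-sub n zero = r1 n
r1-sub zero (suc k) = 0
r1-sub (suc n) (suc k) = r1-sub n k

inv : ∀ {n} → (Fin n → Fin n) → ℕ
inv {n} π = length (filter (λ (p : Fin n × Fin n) → let (i , j) = p in (i <? j) ×-dec (π j <? π i))
                           (concatMap (λ i → map (λ j → (i , j)) (allFin n)) (allFin n)))

i1 : ℕ → ℕ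
i1 n = sum (map inv (involutions n))

{-# OPTIONS --safe #-}
-- Sort the involutions π of [m + 2] by π 0.  Either π fixes 0 and restricts to an involution
-- of the other m + 1 points, or π swaps 0 with some k + 1 and restricts to an involution σ of
-- the other m points.  Relabelling those points in order keeps their mutual inversions.  In the
-- second case 0 is also inverted with k + 1 and with the k other points sent below k + 1 (as
-- many as lie below k + 1, σ being a bijection), and k + 1 with the k points between 0 and
-- k + 1: 2k + 1 more inversions.  Summing over k gives
--   r (m + 2) = r (m + 1) + (m + 1) r m,
--   i (m + 2) = i (m + 1) + (m + 1) i m + (m + 1)² r m,
-- and the closed form satisfies the same recurrence: times 4! it becomes a polynomial identity
-- in m, r m and r (m + 1) once the binomials are written as falling factorials.
module Submission where

open import Defs
open import Data.Nat using (ℕ; _+_; _*_)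
open import Data.Nat.Combinatorics using (_C_)
open import Relation.Binary.PropositionalEquality using (_≡_)

import Algebra.Properties.CommutativeSemigroup as CommSemigroupProperties
open import Data.Bool using (if_then_else_)
open import Data.Empty using (⊥-elim)
open import Data.Fin using (Fin; zero; suc; toℕ; punchIn; punchOut; _≟_; _<?_; _<_)
open import Data.Fin.Properties
  using (all?; suc-injective; 0≢1+n; <⇒≢; ≤∧≢⇒<; punchInᵢ≢i; punchIn-injective; punchIn-mono-≤;
         punchIn-cancel-≤; punchIn-punchOut; punchOut-punchIn; punchOut-cong)
open import Data.List using (List; []; _∷_; map; concatMap; filter; length; allFin; _++_)
open import Data.List.Properties using (map-++; map-∘; map-tabulate; length-tabulate)
open import Data.Nat using (zero; suc; z≤n; z<s; s<s; s<s⁻¹)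
open import Data.Nat.Combinatorics
  using (nCk+nC[k+1]≡[n+1]C[k+1]; nC1≡n; nCn≡1; nCk≡nC[n∸k]; k>n⇒nCk≡0)
open import Data.Nat.ListAction using (sum)
open import Data.Nat.ListAction.Properties using (sum-++)
open import Data.Nat.Properties
  using (<⇒≤; +-assoc; +-identityʳ; *-assoc; *-comm; *-identityˡ; *-identityʳ; *-zeroʳ;
         *-distribˡ-+; *-distribʳ-+; *-cancelˡ-≡; +-commutativeSemigroup; *-commutativeSemigroup)
open import Data.Nat.Tactic.RingSolver using (solve-∀)
open import Data.Product using (_×_; _,_; proj₁; proj₂)
import Data.Vec.Functional as Vec
open import Function using (_∘_; id; _⇔_; mk⇔; Equivalence)
open import Level using (Level; 0ℓ)
open import Relation.Binary.PropositionalEquality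
  using (refl; sym; trans; cong; cong₂; subst; _≢_; _≗_; module ≡-Reasoning)
open import Relation.Nullary using (Dec; yes; no; does; ¬_; ¬?)
open import Relation.Nullary.Decidable using (_×-dec_)
open import Relation.Unary using (Pred; Decidable)

private
  module + = CommSemigroupProperties +-commutativeSemigroup
  module * = CommSemigroupProperties *-commutativeSemigroup

  variable
    a b p q : Level
    A : Set a
    B : Set b
    P : Set p
    Q : Set q
    m n : ℕ

𝟙 : Dec P → ℕ
𝟙 d = if does d then 1 else 0

𝟙-yes : (d : Dec P) → P → 𝟙 d ≡ 1
𝟙-yes (yes _) _  = refl
𝟙-yes (no ¬p) p = ⊥-elim (¬p p)

𝟙-no : (d : Dec P) → ¬ P → 𝟙 d ≡ 0
𝟙-no (yes p) ¬p = ⊥-elim (¬p p)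
𝟙-no (no _)  _  = refl

𝟙-cong : (d : Dec P) (e : Dec Q) → P ⇔ Q → 𝟙 d ≡ 𝟙 e
𝟙-cong (yes p) e P⇔Q = sym (𝟙-yes e (Equivalence.to P⇔Q p))
𝟙-cong (no ¬p) e P⇔Q = sym (𝟙-no e (¬p ∘ Equivalence.from P⇔Q))

𝟙-× : (d : Dec P) (e : Dec Q) → 𝟙 (d ×-dec e) ≡ 𝟙 d * 𝟙 e
𝟙-× (yes _) (yes _) = refl
𝟙-× (yes _) (no _)  = refl
𝟙-× (no _)  _       = refl

𝟙-*-cong : (d : Dec P) {x y : ℕ} → (P → x ≡ y) → 𝟙 d * x ≡ 𝟙 d * y
𝟙-*-cong (yes p) x≡y = cong (_+ 0) (x≡y p)
𝟙-*-cong (no _)  _   = refl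

-- Finite sums

∑ : List A → (A → ℕ) → ℕ
∑ xs f = sum (map f xs)

syntax ∑ xs (λ x → e) = ∑[ x ∈ xs ] e

∑< : (n : ℕ) → (Fin n → ℕ) → ℕ
∑< n = ∑ (allFin n)

syntax ∑< n (λ i → e) = ∑[ i < n ] e

∑-cong : ∀ xs {f g : A → ℕ} → (∀ x → f x ≡ g x) → ∑ xs f ≡ ∑ xs g
∑-cong []       f≗g = refl
∑-cong (x ∷ xs) f≗g = cong₂ _+_ (f≗g x) (∑-cong xs f≗g)

∑-zero : ∀ xs {f : A → ℕ} → (∀ x → f x ≡ 0) → ∑ xs f ≡ 0
∑-zero []       f≗0 = refl
∑-zero (x ∷ xs) f≗0 = cong₂ _+_ (f≗0 x) (∑-zero xs f≗0)

∑-const : ∀ (xs : List A) c → ∑[ x ∈ xs ] c ≡ length xs * c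
∑-const []       c = refl
∑-const (x ∷ xs) c = cong (c +_) (∑-const xs c)

length≡∑1 : ∀ (xs : List A) → length xs ≡ ∑[ x ∈ xs ] 1
length≡∑1 xs = sym (trans (∑-const xs 1) (*-identityʳ (length xs)))

∑-distrib-+ : ∀ xs (f g : A → ℕ) → ∑[ x ∈ xs ] (f x + g x) ≡ ∑ xs f + ∑ xs g
∑-distrib-+ []       f g = refl
∑-distrib-+ (x ∷ xs) f g =
  trans (cong (f x + g x +_) (∑-distrib-+ xs f g)) (+.interchange (f x) (g x) (∑ xs f) (∑ xs g))

*-distribˡ-∑ : ∀ c xs (f : A → ℕ) → c * ∑ xs f ≡ ∑[ x ∈ xs ] (c * f x)
*-distribˡ-∑ c []       f = *-zeroʳ c
*-distribˡ-∑ c (x ∷ xs) f =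
  trans (*-distribˡ-+ c (f x) (∑ xs f)) (cong (c * f x +_) (*-distribˡ-∑ c xs f))

*-distribʳ-∑ : ∀ c xs (f : A → ℕ) → ∑ xs f * c ≡ ∑[ x ∈ xs ] (f x * c)
*-distribʳ-∑ c xs f =
  trans (*-comm (∑ xs f) c) (trans (*-distribˡ-∑ c xs f) (∑-cong xs (λ x → *-comm c (f x))))

∑-++ : ∀ xs ys (f : A → ℕ) → ∑ (xs ++ ys) f ≡ ∑ xs f + ∑ ys f
∑-++ xs ys f = trans (cong sum (map-++ f xs ys)) (sum-++ (map f xs) (map f ys))

∑-map : ∀ (φ : A → B) xs (f : B → ℕ) → ∑ (map φ xs) f ≡ ∑ xs (f ∘ φ)
∑-map φ xs f = cong sum (sym (map-∘ xs))

∑-concatMap : ∀ (F : A → List B) xs (f : B → ℕ) → ∑ (concatMap F xs) f ≡ ∑[ x ∈ xs ] ∑ (F x) f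
∑-concatMap F []       f = refl
∑-concatMap F (x ∷ xs) f =
  trans (∑-++ (F x) (concatMap F xs) f) (cong (∑ (F x) f +_) (∑-concatMap F xs f))

∑-comm : ∀ xs ys (h : A → B → ℕ) → ∑[ x ∈ xs ] ∑[ y ∈ ys ] h x y ≡ ∑[ y ∈ ys ] ∑[ x ∈ xs ] h x y
∑-comm []       ys h = sym (∑-zero ys (λ _ → refl))
∑-comm (x ∷ xs) ys h = trans (cong (∑ ys (h x) +_) (∑-comm xs ys h))
                             (sym (∑-distrib-+ ys (h x) (λ y → ∑[ x′ ∈ xs ] h x′ y)))

∑-filter : ∀ {P : Pred A p} (P? : Decidable P) xs (f : A → ℕ) →
           ∑ (filter P? xs) f ≡ ∑[ x ∈ xs ] (𝟙 (P? x) * f x)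
∑-filter P? []       f = refl
∑-filter P? (x ∷ xs) f with P? x
... | yes _ = cong₂ _+_ (sym (+-identityʳ (f x))) (∑-filter P? xs f)
... | no  _ = ∑-filter P? xs f

∑-filter-cong : ∀ {P : Pred A p} (P? : Decidable P) xs {f g : A → ℕ} →
                (∀ x → P x → f x ≡ g x) → ∑ (filter P? xs) f ≡ ∑ (filter P? xs) g
∑-filter-cong P? xs {f} {g} eq = begin
  ∑ (filter P? xs) f             ≡⟨ ∑-filter P? xs f ⟩
  ∑[ x ∈ xs ] (𝟙 (P? x) * f x)   ≡⟨ ∑-cong xs (λ x → 𝟙-*-cong (P? x) (eq x)) ⟩
  ∑[ x ∈ xs ] (𝟙 (P? x) * g x)   ≡⟨ ∑-filter P? xs g ⟨
  ∑ (filter P? xs) g             ∎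
  where open ≡-Reasoning

∑-pick : ∀ xs {P : Pred A p} (P? : Decidable P) {h : A → ℕ} {x₀ : A} →
         ∑[ x ∈ xs ] 𝟙 (P? x) ≡ 1 → (∀ x → P x → h x ≡ h x₀) →
         ∑[ x ∈ xs ] (𝟙 (P? x) * h x) ≡ h x₀
∑-pick xs P? {h} {x₀} once P⇒≡ = begin
  ∑[ x ∈ xs ] (𝟙 (P? x) * h x)   ≡⟨ ∑-cong xs (λ x → 𝟙-*-cong (P? x) (P⇒≡ x)) ⟩
  ∑[ x ∈ xs ] (𝟙 (P? x) * h x₀)  ≡⟨ *-distribʳ-∑ (h x₀) xs (𝟙 ∘ P?) ⟨
  ∑[ x ∈ xs ] 𝟙 (P? x) * h x₀    ≡⟨ cong (_* h x₀) once ⟩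
  1 * h x₀                       ≡⟨ *-identityˡ (h x₀) ⟩
  h x₀                           ∎
  where open ≡-Reasoning

∑<-suc : ∀ n (h : Fin (suc n) → ℕ) → ∑[ i < suc n ] h i ≡ h zero + ∑[ i < n ] h (suc i)
∑<-suc n h = cong (λ t → h zero + sum t) (trans (map-tabulate suc h) (sym (map-tabulate id (h ∘ suc))))

∑<-const : ∀ n c → ∑[ i < n ] c ≡ n * c
∑<-const n c = trans (∑-const (allFin n) c) (cong (_* c) (length-tabulate {n = n} id))

∑<-punchIn : ∀ (k : Fin (suc n)) (h : Fin (suc n) → ℕ) →
             ∑[ i < suc n ] h i ≡ h k + ∑[ i < n ] h (punchIn k i)
∑<-punchIn {n}     zero    h = ∑<-suc n h
∑<-punchIn {suc n} (suc k) h = begin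
  ∑[ i < suc (suc n) ] h i                                ≡⟨ ∑<-suc (suc n) h ⟩
  h zero + ∑[ i < suc n ] h (suc i)                       ≡⟨ cong (h zero +_) (∑<-punchIn k (h ∘ suc)) ⟩
  h zero + (h (suc k) + ∑[ i < n ] h (suc (punchIn k i))) ≡⟨ +.x∙yz≈y∙xz (h zero) (h (suc k)) _ ⟩
  h (suc k) + (h zero + ∑[ i < n ] h (suc (punchIn k i))) ≡⟨ cong (h (suc k) +_) (∑<-suc n (h ∘ punchIn (suc k))) ⟨
  h (suc k) + ∑[ i < suc n ] h (punchIn (suc k) i)        ∎
  where open ≡-Reasoning

∑<-concentrated : ∀ (k : Fin n) (h : Fin n → ℕ) → (∀ i → i ≢ k → h i ≡ 0) → ∑[ i < n ] h i ≡ h k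
∑<-concentrated {suc n} k h vanish = begin
  ∑[ i < suc n ] h i                ≡⟨ ∑<-punchIn k h ⟩
  h k + ∑[ i < n ] h (punchIn k i)  ≡⟨ cong (h k +_) (∑-zero (allFin n) (λ i → vanish _ (punchInᵢ≢i k i))) ⟩
  h k + 0                           ≡⟨ +-identityʳ (h k) ⟩
  h k                               ∎
  where open ≡-Reasoning

count-≟ : ∀ (k : Fin n) → ∑[ i < n ] 𝟙 (k ≟ i) ≡ 1
count-≟ k = trans (∑<-concentrated k (λ i → 𝟙 (k ≟ i)) (λ i i≢k → 𝟙-no (k ≟ i) (i≢k ∘ sym)))
                  (𝟙-yes (k ≟ k) refl)

∑<-pick : ∀ (k : Fin n) (h : Fin n → ℕ) → ∑[ i < n ] (𝟙 (k ≟ i) * h i) ≡ h k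
∑<-pick k h = ∑-pick (allFin _) (k ≟_) (count-≟ k) (λ i k≡i → cong h (sym k≡i))

∑<-reindex-involution : ∀ (σ : Fin n → Fin n) → IsInvolution σ → (h : Fin n → ℕ) →
                        ∑[ i < n ] h (σ i) ≡ ∑[ i < n ] h i
∑<-reindex-involution {n} σ σσ≗id h = begin
  ∑[ i < n ] h (σ i)
    ≡⟨ ∑-cong (allFin n) (λ i → ∑<-pick (σ i) h) ⟨
  ∑[ i < n ] ∑[ j < n ] (𝟙 (σ i ≟ j) * h j)
    ≡⟨ ∑-comm (allFin n) (allFin n) (λ i j → 𝟙 (σ i ≟ j) * h j) ⟩
  ∑[ j < n ] ∑[ i < n ] (𝟙 (σ i ≟ j) * h j)
    ≡⟨ ∑-cong (allFin n) (λ j → ∑-cong (allFin n) (λ i →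
         cong (_* h j) (𝟙-cong (σ i ≟ j) (σ j ≟ i) (flip i j)))) ⟩
  ∑[ j < n ] ∑[ i < n ] (𝟙 (σ j ≟ i) * h j)
    ≡⟨ ∑-cong (allFin n) (λ j →
         ∑-pick (allFin n) (σ j ≟_) {h = λ _ → h j} {x₀ = j} (count-≟ (σ j)) (λ _ _ → refl)) ⟩
  ∑[ j < n ] h j ∎
  where
  open ≡-Reasoning
  flip : ∀ i j → σ i ≡ j ⇔ σ j ≡ i
  flip i j = mk⇔ (λ σi≡j → trans (cong σ (sym σi≡j)) (σσ≗id i))
                 (λ σj≡i → trans (cong σ (sym σj≡i)) (σσ≗id j))

-- Sums over functions and over involutions

Endo : ℕ → Set
Endo n = Fin n → Fin n

-- Without function extensionality the enumerated functions can only be compared pointwise,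
-- so every summand over them has to respect _≗_.
Invariant : ((Fin m → Fin n) → ℕ) → Set
Invariant h = ∀ {f g} → f ≗ g → h f ≡ h g

_≗?_ : (f g : Fin m → Fin n) → Dec (f ≗ g)
f ≗? g = all? (λ i → f i ≟ g i)

≗-⇔ʳ : {x f g : Fin m → Fin n} → f ≗ g → x ≗ f ⇔ x ≗ g
≗-⇔ʳ f≗g = mk⇔ (λ x≗f i → trans (x≗f i) (f≗g i)) (λ x≗g i → trans (x≗g i) (sym (f≗g i)))

≗-⇔-sym : {f g : Fin m → Fin n} → f ≗ g ⇔ g ≗ f
≗-⇔-sym = mk⇔ (λ f≗g → sym ∘ f≗g) (λ g≗f → sym ∘ g≗f)

≗-∷-⇔ : ∀ {x : Fin (suc m) → Fin n} {j f} → x ≗ (j Vec.∷ f) ⇔ (x zero ≡ j × Vec.tail x ≗ f)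
≗-∷-⇔ = mk⇔ (λ x≗j∷f → x≗j∷f zero , x≗j∷f ∘ suc)
            (λ { (x₀≡j , _) zero → x₀≡j ; (_ , x⁺≗f) (suc i) → x⁺≗f i })

∑-allFuns-suc : ∀ m n (h : (Fin (suc m) → Fin n) → ℕ) → Invariant h →
                ∑[ f ∈ allFuns (suc m) n ] h f ≡ ∑[ f ∈ allFuns m n ] ∑[ j < n ] h (j Vec.∷ f)
∑-allFuns-suc m n h h-inv = trans (∑-concatMap _ (allFuns m n) h)
  (∑-cong (allFuns m n) (λ f → trans (∑-map _ (allFin n) h)
    (∑-cong (allFin n) (λ j → h-inv λ { zero → refl ; (suc i) → refl }))))

count-≗ : ∀ m (x : Fin m → Fin n) → ∑[ f ∈ allFuns m n ] 𝟙 (x ≗? f) ≡ 1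
count-≗     zero    x = 𝟙-yes (x ≗? λ ()) (λ ())
count-≗ {n} (suc m) x = begin
  ∑[ f ∈ allFuns (suc m) n ] 𝟙 (x ≗? f)
    ≡⟨ ∑-allFuns-suc m n (λ f → 𝟙 (x ≗? f)) (λ {f} {g} f≗g → 𝟙-cong (x ≗? f) (x ≗? g) (≗-⇔ʳ f≗g)) ⟩
  ∑[ f ∈ allFuns m n ] ∑[ j < n ] 𝟙 (x ≗? (j Vec.∷ f))
    ≡⟨ ∑-cong (allFuns m n) (λ f → ∑-cong (allFin n) (λ j →
         trans (𝟙-cong (x ≗? (j Vec.∷ f)) ((x zero ≟ j) ×-dec (Vec.tail x ≗? f)) ≗-∷-⇔)
               (𝟙-× (x zero ≟ j) (Vec.tail x ≗? f)))) ⟩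
  ∑[ f ∈ allFuns m n ] ∑[ j < n ] (𝟙 (x zero ≟ j) * 𝟙 (Vec.tail x ≗? f))
    ≡⟨ ∑-cong (allFuns m n) (λ f → ∑<-pick (x zero) (λ _ → 𝟙 (Vec.tail x ≗? f))) ⟩
  ∑[ f ∈ allFuns m n ] 𝟙 (Vec.tail x ≗? f)
    ≡⟨ count-≗ m (Vec.tail x) ⟩
  1 ∎
  where open ≡-Reasoning

∑-allFuns-pick : ∀ (x : Fin m → Fin n) (h : (Fin m → Fin n) → ℕ) → Invariant h →
                 ∑[ f ∈ allFuns m n ] (𝟙 (x ≗? f) * h f) ≡ h x
∑-allFuns-pick {m} {n} x h h-inv =
  ∑-pick (allFuns m n) (x ≗?_) (count-≗ m x) (λ f x≗f → h-inv (sym ∘ x≗f))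

isInvolution-cong : {σ τ : Endo n} → σ ≗ τ → IsInvolution σ → IsInvolution τ
isInvolution-cong {σ = σ} {τ} σ≗τ σσ≗id i =
  trans (sym (σ≗τ (τ i))) (trans (cong σ (sym (σ≗τ i))) (σσ≗id i))

count-involutions : ∀ (τ : Endo n) → ∑[ σ ∈ involutions n ] 𝟙 (σ ≗? τ) ≡ 𝟙 (isInvolution? τ)
count-involutions {n} τ = begin
  ∑[ σ ∈ involutions n ] 𝟙 (σ ≗? τ)
    ≡⟨ ∑-filter isInvolution? (allFuns n n) (λ σ → 𝟙 (σ ≗? τ)) ⟩
  ∑[ σ ∈ allFuns n n ] (𝟙 (isInvolution? σ) * 𝟙 (σ ≗? τ))
    ≡⟨ ∑-cong (allFuns n n) (λ σ → trans (*-comm (𝟙 (isInvolution? σ)) _)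
         (cong (_* 𝟙 (isInvolution? σ)) (𝟙-cong (σ ≗? τ) (τ ≗? σ) ≗-⇔-sym))) ⟩
  ∑[ σ ∈ allFuns n n ] (𝟙 (τ ≗? σ) * 𝟙 (isInvolution? σ))
    ≡⟨ ∑-allFuns-pick τ (𝟙 ∘ isInvolution?) 𝟙-isInvolution-cong ⟩
  𝟙 (isInvolution? τ) ∎
  where
  open ≡-Reasoning
  𝟙-isInvolution-cong : Invariant (𝟙 ∘ isInvolution? {n})
  𝟙-isInvolution-cong {σ} {τ} σ≗τ = 𝟙-cong (isInvolution? σ) (isInvolution? τ)
    (mk⇔ (isInvolution-cong σ≗τ) (isInvolution-cong (sym ∘ σ≗τ)))

-- For a map φ with image Image and left inverse ψ, as in ∑-involutions-reindex, this is
-- the number of involutions σ with φ σ ≗ u.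
#preimages : {Image : Pred (Endo n) q} → Decidable Image → (Endo n → Endo m) → Endo n → ℕ
#preimages Image? ψ u = 𝟙 (Image? u) * 𝟙 (isInvolution? (ψ u))

#preimages-outside : ∀ {Image : Pred (Endo n) q} (Image? : Decidable Image) (ψ : Endo n → Endo m) u →
                     ¬ Image u → #preimages Image? ψ u ≡ 0
#preimages-outside Image? ψ u ¬image = cong (_* 𝟙 (isInvolution? (ψ u))) (𝟙-no (Image? u) ¬image)

∑-involutions-reindex : ∀ {Image : Pred (Endo n) q} (Image? : Decidable Image)
  (φ : Endo m → Endo n) (ψ : Endo n → Endo m) → (∀ σ u → φ σ ≗ u ⇔ (Image u × σ ≗ ψ u)) →
  ∀ (g : Endo n → ℕ) → Invariant g →
  ∑[ σ ∈ involutions m ] g (φ σ) ≡ ∑[ u ∈ allFuns n n ] (#preimages Image? ψ u * g u)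
∑-involutions-reindex {n} {m = m} Image? φ ψ φ≗⇔ g g-inv = begin
  ∑[ σ ∈ involutions m ] g (φ σ)
    ≡⟨ ∑-cong (involutions m) (λ σ → ∑-allFuns-pick (φ σ) g g-inv) ⟨
  ∑[ σ ∈ involutions m ] ∑[ u ∈ allFuns n n ] (𝟙 (φ σ ≗? u) * g u)
    ≡⟨ ∑-comm (involutions m) (allFuns n n) (λ σ u → 𝟙 (φ σ ≗? u) * g u) ⟩
  ∑[ u ∈ allFuns n n ] ∑[ σ ∈ involutions m ] (𝟙 (φ σ ≗? u) * g u)
    ≡⟨ ∑-cong (allFuns n n) column ⟩
  ∑[ u ∈ allFuns n n ] (#preimages Image? ψ u * g u) ∎
  where
  open ≡-Reasoning
  column : ∀ u → ∑[ σ ∈ involutions m ] (𝟙 (φ σ ≗? u) * g u) ≡ #preimages Image? ψ u * g u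
  column u = begin
    ∑[ σ ∈ involutions m ] (𝟙 (φ σ ≗? u) * g u)
      ≡⟨ ∑-cong (involutions m) (λ σ → cong (_* g u)
           (trans (𝟙-cong (φ σ ≗? u) (Image? u ×-dec (σ ≗? ψ u)) (φ≗⇔ σ u))
                  (𝟙-× (Image? u) (σ ≗? ψ u)))) ⟩
    ∑[ σ ∈ involutions m ] (𝟙 (Image? u) * 𝟙 (σ ≗? ψ u) * g u)
      ≡⟨ ∑-cong (involutions m) (λ σ → *.xy∙z≈xz∙y (𝟙 (Image? u)) (𝟙 (σ ≗? ψ u)) (g u)) ⟩
    ∑[ σ ∈ involutions m ] (𝟙 (Image? u) * g u * 𝟙 (σ ≗? ψ u))
      ≡⟨ *-distribˡ-∑ (𝟙 (Image? u) * g u) (involutions m) (λ σ → 𝟙 (σ ≗? ψ u)) ⟨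
    𝟙 (Image? u) * g u * ∑[ σ ∈ involutions m ] 𝟙 (σ ≗? ψ u)
      ≡⟨ cong (𝟙 (Image? u) * g u *_) (count-involutions (ψ u)) ⟩
    𝟙 (Image? u) * g u * 𝟙 (isInvolution? (ψ u))
      ≡⟨ *.xy∙z≈xz∙y (𝟙 (Image? u)) (g u) (𝟙 (isInvolution? (ψ u))) ⟩
    #preimages Image? ψ u * g u ∎

-- Involutions fixing 0

lift₀ : Endo n → Endo (suc n)
lift₀ σ zero    = zero
lift₀ σ (suc i) = suc (σ i)

unsuc : Fin n → Fin (suc n) → Fin n
unsuc d zero    = d
unsuc d (suc w) = w

suc-unsuc : ∀ (d : Fin n) {w : Fin (suc n)} → w ≢ zero → suc (unsuc d w) ≡ w
suc-unsuc d {zero}  w≢0 = ⊥-elim (w≢0 refl)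
suc-unsuc d {suc w} _   = refl

-- The argument i of unsuc only matters outside the image of lift₀; it stands in for an
-- element of Fin n, which may be empty.
unlift₀ : Endo (suc n) → Endo n
unlift₀ u i = unsuc i (u (suc i))

IsLift₀ : Pred (Endo (suc n)) 0ℓ
IsLift₀ u = u zero ≡ zero × (∀ i → u (suc i) ≢ zero)

isLift₀? : Decidable (IsLift₀ {n})
isLift₀? u = (u zero ≟ zero) ×-dec all? (λ i → ¬? (u (suc i) ≟ zero))

lift₀-≗⇔ : ∀ (σ : Endo n) u → lift₀ σ ≗ u ⇔ (IsLift₀ u × σ ≗ unlift₀ u)
lift₀-≗⇔ σ u = mk⇔ to from
  where
  to : lift₀ σ ≗ u → IsLift₀ u × σ ≗ unlift₀ u
  to σ₀≗u = (sym (σ₀≗u zero) , λ i → 0≢1+n ∘ sym ∘ trans (σ₀≗u (suc i)))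
          , λ i → cong (unsuc i) (σ₀≗u (suc i))
  from : IsLift₀ u × σ ≗ unlift₀ u → lift₀ σ ≗ u
  from ((u0≡0 , _)    , _)    zero    = sym u0≡0
  from ((_    , u⁺≢0) , σ≗ψu) (suc i) = trans (cong suc (σ≗ψu i)) (suc-unsuc i (u⁺≢0 i))

lift₀-involution⇔ : ∀ (u : Endo (suc n)) → u zero ≡ zero →
                    IsInvolution u ⇔ (IsLift₀ u × IsInvolution (unlift₀ u))
lift₀-involution⇔ u u0≡0 = mk⇔ to from
  where
  open ≡-Reasoning
  to : IsInvolution u → IsLift₀ u × IsInvolution (unlift₀ u)
  to uu≗id = (u0≡0 , u⁺≢0) , λ i → cong (unsuc _) (begin
      u (suc (unlift₀ u i))  ≡⟨ cong u (suc-unsuc i (u⁺≢0 i)) ⟩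
      u (u (suc i))          ≡⟨ uu≗id (suc i) ⟩
      suc i                  ∎)
    where
    u⁺≢0 : ∀ i → u (suc i) ≢ zero
    u⁺≢0 i u⁺≡0 = 0≢1+n (trans (sym u0≡0) (trans (cong u (sym u⁺≡0)) (uu≗id (suc i))))
  from : IsLift₀ u × IsInvolution (unlift₀ u) → IsInvolution u
  from ((_ , u⁺≢0) , ψψ≗id) zero    = trans (cong u u0≡0) u0≡0
  from ((_ , u⁺≢0) , ψψ≗id) (suc i) = begin
    u (u (suc i))                  ≡⟨ cong u (suc-unsuc i (u⁺≢0 i)) ⟨
    u (suc (unlift₀ u i))          ≡⟨ suc-unsuc _ (u⁺≢0 _) ⟨
    suc (unlift₀ u (unlift₀ u i))  ≡⟨ cong suc (ψψ≗id i) ⟩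
    suc i                          ∎

-- Involutions exchanging 0 and suc k

embed : Fin (suc m) → Fin m → Fin (suc (suc m))
embed k j = suc (punchIn k j)

Embedded : Fin (suc m) → Pred (Fin (suc (suc m))) 0ℓ
Embedded k w = w ≢ zero × w ≢ suc k

embedded? : ∀ (k : Fin (suc m)) → Decidable (Embedded k)
embedded? k w = ¬? (w ≟ zero) ×-dec ¬? (w ≟ suc k)

embed-embedded : ∀ (k : Fin (suc m)) j → Embedded k (embed k j)
embed-embedded k j = 0≢1+n ∘ sym , punchInᵢ≢i k j ∘ suc-injective

data Position (k : Fin (suc m)) : Fin (suc (suc m)) → Set where
  at-zero  : Position k zero
  at-pair  : Position k (suc k)
  at-embed : ∀ j → Position k (embed k j)

position : ∀ (k : Fin (suc m)) i → Position k i
position k zero    = at-zero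
position k (suc i) with k ≟ i
... | yes refl = at-pair
... | no  k≢i  = subst (Position k) (cong suc (punchIn-punchOut k≢i)) (at-embed (punchOut k≢i))

punchOut-punchIn′ : ∀ (k : Fin (suc m)) {j} (k≢k+j : k ≢ punchIn k j) → punchOut k≢k+j ≡ j
punchOut-punchIn′ k k≢k+j = trans (punchOut-cong k refl) (punchOut-punchIn k)

unembed : Fin (suc m) → Fin m → Fin (suc (suc m)) → Fin m
unembed k d zero    = d
unembed k d (suc w) with k ≟ w
... | yes _   = d
... | no  k≢w = punchOut k≢w

unembed-embed : ∀ (k : Fin (suc m)) d j → unembed k d (embed k j) ≡ j
unembed-embed k d j with k ≟ punchIn k j
... | yes k≡k+j = ⊥-elim (punchInᵢ≢i k j (sym k≡k+j))
... | no  k≢k+j = punchOut-punchIn′ k k≢k+j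

embed-unembed : ∀ (k : Fin (suc m)) d {w} → Embedded k w → embed k (unembed k d w) ≡ w
embed-unembed k d {w} (w≢0 , w≢k+1) with position k w
... | at-zero    = ⊥-elim (w≢0 refl)
... | at-pair    = ⊥-elim (w≢k+1 refl)
... | at-embed j = cong (embed k) (unembed-embed k d j)

pair₀ : Fin (suc m) → Endo m → Endo (suc (suc m))
pair₀ k σ zero    = suc k
pair₀ k σ (suc i) with k ≟ i
... | yes _   = zero
... | no  k≢i = embed k (σ (punchOut k≢i))

pair₀-pair : ∀ (k : Fin (suc m)) σ → pair₀ k σ (suc k) ≡ zero
pair₀-pair k σ with k ≟ k
... | yes _   = refl
... | no  k≢k = ⊥-elim (k≢k refl)

pair₀-embed : ∀ (k : Fin (suc m)) σ j → pair₀ k σ (embed k j) ≡ embed k (σ j)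
pair₀-embed k σ j with k ≟ punchIn k j
... | yes k≡k+j = ⊥-elim (punchInᵢ≢i k j (sym k≡k+j))
... | no  k≢k+j = cong (embed k ∘ σ) (punchOut-punchIn′ k k≢k+j)

unpair₀ : Fin (suc m) → Endo (suc (suc m)) → Endo m
unpair₀ k u j = unembed k j (u (embed k j))

IsPair₀ : Fin (suc m) → Pred (Endo (suc (suc m))) 0ℓ
IsPair₀ k u = u zero ≡ suc k × u (suc k) ≡ zero × (∀ j → Embedded k (u (embed k j)))

isPair₀? : ∀ (k : Fin (suc m)) → Decidable (IsPair₀ k)
isPair₀? k u = (u zero ≟ suc k) ×-dec (u (suc k) ≟ zero) ×-dec all? (λ j → embedded? k (u (embed k j)))

pair₀-≗⇔ : ∀ (k : Fin (suc m)) σ u → pair₀ k σ ≗ u ⇔ (IsPair₀ k u × σ ≗ unpair₀ k u)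
pair₀-≗⇔ k σ u = mk⇔ to from
  where
  to : pair₀ k σ ≗ u → IsPair₀ k u × σ ≗ unpair₀ k u
  to πₖ≗u = (sym (πₖ≗u zero) , trans (sym (πₖ≗u (suc k))) (pair₀-pair k σ)
            , λ j → subst (Embedded k) (u-embed j) (embed-embedded k (σ j)))
          , λ j → trans (sym (unembed-embed k j (σ j))) (cong (unembed k j) (u-embed j))
    where
    u-embed : ∀ j → embed k (σ j) ≡ u (embed k j)
    u-embed j = trans (sym (pair₀-embed k σ j)) (πₖ≗u (embed k j))
  from : IsPair₀ k u × σ ≗ unpair₀ k u → pair₀ k σ ≗ u
  from ((u0≡k+1 , uk+1≡0 , u-embedded) , σ≗ψu) i with position k i
  ... | at-zero    = sym u0≡k+1
  ... | at-pair    = trans (pair₀-pair k σ) (sym uk+1≡0)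
  ... | at-embed j = begin
    pair₀ k σ (embed k j)    ≡⟨ pair₀-embed k σ j ⟩
    embed k (σ j)            ≡⟨ cong (embed k) (σ≗ψu j) ⟩
    embed k (unpair₀ k u j)  ≡⟨ embed-unembed k j (u-embedded j) ⟩
    u (embed k j)            ∎
    where open ≡-Reasoning

pair₀-involution⇔ : ∀ (k : Fin (suc m)) u → u zero ≡ suc k →
                    IsInvolution u ⇔ (IsPair₀ k u × IsInvolution (unpair₀ k u))
pair₀-involution⇔ {m} k u u0≡k+1 = mk⇔ to from
  where
  open ≡-Reasoning
  ψ : Endo m
  ψ = unpair₀ k u
  u-embed : (∀ j → Embedded k (u (embed k j))) → ∀ j → u (embed k j) ≡ embed k (ψ j)
  u-embed u-embedded j = sym (embed-unembed k j (u-embedded j))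
  to : IsInvolution u → IsPair₀ k u × IsInvolution ψ
  to uu≗id = (u0≡k+1 , uk+1≡0 , u-embedded) , λ j → begin
      ψ (ψ j)                      ≡⟨ cong (unembed k (ψ j)) (begin
        u (embed k (ψ j))            ≡⟨ cong u (u-embed u-embedded j) ⟨
        u (u (embed k j))            ≡⟨ uu≗id (embed k j) ⟩
        embed k j                    ∎) ⟩
      unembed k (ψ j) (embed k j)  ≡⟨ unembed-embed k (ψ j) j ⟩
      j                            ∎
    where
    uk+1≡0 : u (suc k) ≡ zero
    uk+1≡0 = trans (cong u (sym u0≡k+1)) (uu≗id zero)
    u² : ∀ j {w v} → u (embed k j) ≡ w → u w ≡ v → embed k j ≡ v
    u² j uj≡w uw≡v = trans (sym (uu≗id (embed k j))) (trans (cong u uj≡w) uw≡v)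
    u-embedded : ∀ j → Embedded k (u (embed k j))
    u-embedded j = (λ uj≡0   → punchInᵢ≢i k j (suc-injective (u² j uj≡0 u0≡k+1)))
                 , (λ uj≡k+1 → 0≢1+n (sym (u² j uj≡k+1 uk+1≡0)))
  from : IsPair₀ k u × IsInvolution ψ → IsInvolution u
  from ((_ , uk+1≡0 , u-embedded) , ψψ≗id) i with position k i
  ... | at-zero    = trans (cong u u0≡k+1) uk+1≡0
  ... | at-pair    = trans (cong u uk+1≡0) u0≡k+1
  ... | at-embed j = begin
    u (u (embed k j))  ≡⟨ cong u (u-embed u-embedded j) ⟩
    u (embed k (ψ j))  ≡⟨ u-embed u-embedded (ψ j) ⟩
    embed k (ψ (ψ j))  ≡⟨ cong (embed k) (ψψ≗id j) ⟩
    embed k j          ∎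

#decompositions : Endo (suc (suc m)) → ℕ
#decompositions {m} u =
  #preimages isLift₀? unlift₀ u + ∑[ k < suc m ] #preimages (isPair₀? k) (unpair₀ k) u

𝟙-isInvolution≡#decompositions : ∀ (u : Endo (suc (suc m))) → 𝟙 (isInvolution? u) ≡ #decompositions u
𝟙-isInvolution≡#decompositions {m} u = by-image-of-zero (u zero) refl
  where
  open ≡-Reasoning
  L : ℕ
  L = #preimages isLift₀? unlift₀ u
  N : Fin (suc m) → ℕ
  N k = #preimages (isPair₀? k) (unpair₀ k) u
  by-image-of-zero : ∀ v → u zero ≡ v → 𝟙 (isInvolution? u) ≡ #decompositions u
  by-image-of-zero zero u0≡0 = begin
    𝟙 (isInvolution? u)
      ≡⟨ 𝟙-cong (isInvolution? u) (isLift₀? u ×-dec isInvolution? (unlift₀ u)) (lift₀-involution⇔ u u0≡0) ⟩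
    𝟙 (isLift₀? u ×-dec isInvolution? (unlift₀ u))
      ≡⟨ 𝟙-× (isLift₀? u) (isInvolution? (unlift₀ u)) ⟩
    L
      ≡⟨ +-identityʳ L ⟨
    L + 0
      ≡⟨ cong (L +_) (∑-zero (allFin (suc m)) no-pair) ⟨
    L + ∑[ k < suc m ] N k ∎
    where
    no-pair : ∀ k → N k ≡ 0
    no-pair k = #preimages-outside (isPair₀? k) (unpair₀ k) u
      (λ (u0≡k+1 , _) → 0≢1+n (trans (sym u0≡0) u0≡k+1))
  by-image-of-zero (suc k₀) u0≡k₀+1 = begin
    𝟙 (isInvolution? u)
      ≡⟨ 𝟙-cong (isInvolution? u) (isPair₀? k₀ u ×-dec isInvolution? (unpair₀ k₀ u))
                (pair₀-involution⇔ k₀ u u0≡k₀+1) ⟩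
    𝟙 (isPair₀? k₀ u ×-dec isInvolution? (unpair₀ k₀ u))
      ≡⟨ 𝟙-× (isPair₀? k₀ u) (isInvolution? (unpair₀ k₀ u)) ⟩
    N k₀
      ≡⟨ ∑<-concentrated k₀ N other-pair ⟨
    ∑[ k < suc m ] N k
      ≡⟨ cong (_+ ∑[ k < suc m ] N k) no-lift ⟨
    L + ∑[ k < suc m ] N k ∎
    where
    no-lift : L ≡ 0
    no-lift = #preimages-outside isLift₀? unlift₀ u (λ (u0≡0 , _) → 0≢1+n (trans (sym u0≡0) u0≡k₀+1))
    other-pair : ∀ k → k ≢ k₀ → N k ≡ 0
    other-pair k k≢k₀ = #preimages-outside (isPair₀? k) (unpair₀ k) u
      (λ (u0≡k+1 , _) → k≢k₀ (suc-injective (trans (sym u0≡k+1) u0≡k₀+1)))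

∑-involutions-suc-suc : ∀ m (g : Endo (suc (suc m)) → ℕ) → Invariant g →
  ∑[ π ∈ involutions (suc (suc m)) ] g π ≡
  ∑[ σ ∈ involutions (suc m) ] g (lift₀ σ) + ∑[ k < suc m ] ∑[ σ ∈ involutions m ] g (pair₀ k σ)
∑-involutions-suc-suc m g g-inv = begin
  ∑[ π ∈ involutions (suc (suc m)) ] g π
    ≡⟨ ∑-filter isInvolution? U g ⟩
  ∑[ u ∈ U ] (𝟙 (isInvolution? u) * g u)
    ≡⟨ ∑-cong U (λ u → trans (cong (_* g u) (𝟙-isInvolution≡#decompositions u)) (distrib u)) ⟩
  ∑[ u ∈ U ] (L u * g u + ∑[ k < suc m ] (N k u * g u))
    ≡⟨ ∑-distrib-+ U (λ u → L u * g u) (λ u → ∑[ k < suc m ] (N k u * g u)) ⟩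
  ∑[ u ∈ U ] (L u * g u) + ∑[ u ∈ U ] ∑[ k < suc m ] (N k u * g u)
    ≡⟨ cong (∑[ u ∈ U ] (L u * g u) +_) (∑-comm U (allFin (suc m)) (λ u k → N k u * g u)) ⟩
  ∑[ u ∈ U ] (L u * g u) + ∑[ k < suc m ] ∑[ u ∈ U ] (N k u * g u)
    ≡⟨ cong₂ _+_ (∑-involutions-reindex isLift₀? lift₀ unlift₀ lift₀-≗⇔ g g-inv)
                 (∑-cong (allFin (suc m)) λ k →
                    ∑-involutions-reindex (isPair₀? k) (pair₀ k) (unpair₀ k) (pair₀-≗⇔ k) g g-inv) ⟨
  ∑[ σ ∈ involutions (suc m) ] g (lift₀ σ) + ∑[ k < suc m ] ∑[ σ ∈ involutions m ] g (pair₀ k σ) ∎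
  where
  open ≡-Reasoning
  U : List (Endo (suc (suc m)))
  U = allFuns (suc (suc m)) (suc (suc m))
  L : Endo (suc (suc m)) → ℕ
  L = #preimages isLift₀? unlift₀
  N : Fin (suc m) → Endo (suc (suc m)) → ℕ
  N k = #preimages (isPair₀? k) (unpair₀ k)
  distrib : ∀ u → (L u + ∑[ k < suc m ] N k u) * g u ≡ L u * g u + ∑[ k < suc m ] (N k u * g u)
  distrib u = trans (*-distribʳ-+ (g u) (L u) _)
                    (cong (L u * g u +_) (*-distribʳ-∑ (g u) (allFin (suc m)) (λ k → N k u)))

-- Inversions

𝟙-<-zero : ∀ {n} (i : Fin m) → 𝟙 (i <? zero {n}) ≡ 0
𝟙-<-zero {n = n} i = 𝟙-no (i <? zero {n}) (λ ())

𝟙-zero-<-suc : ∀ {m} (j : Fin n) → 𝟙 (zero {m} <? suc j) ≡ 1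
𝟙-zero-<-suc {m = m} j = 𝟙-yes (zero {m} <? suc j) z<s

𝟙-suc-<-suc : ∀ (i : Fin m) (j : Fin n) → 𝟙 (suc i <? suc j) ≡ 𝟙 (i <? j)
𝟙-suc-<-suc i j = 𝟙-cong (suc i <? suc j) (i <? j) (mk⇔ s<s⁻¹ s<s)

𝟙-<-cong : ∀ {i i′ : Fin m} {j j′ : Fin n} → i ≡ i′ → j ≡ j′ → 𝟙 (i <? j) ≡ 𝟙 (i′ <? j′)
𝟙-<-cong refl refl = refl

punchIn-<-⇔ : ∀ (k : Fin (suc m)) {i j} → punchIn k i < punchIn k j ⇔ i < j
punchIn-<-⇔ k {i} {j} = mk⇔
  (λ ki<kj → ≤∧≢⇒< (punchIn-cancel-≤ k i j (<⇒≤ ki<kj)) (<⇒≢ ki<kj ∘ cong (punchIn k)))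
  (λ i<j → ≤∧≢⇒< (punchIn-mono-≤ k i j (<⇒≤ i<j)) (<⇒≢ i<j ∘ punchIn-injective k i j))

punchInₖ-<-⇔ : ∀ (k : Fin (suc m)) j → punchIn k j < k ⇔ j < k
punchInₖ-<-⇔ zero    j       = mk⇔ (λ ()) (λ ())
punchInₖ-<-⇔ (suc k) zero    = mk⇔ (λ _ → z<s) (λ _ → z<s)
punchInₖ-<-⇔ (suc k) (suc j) =
  mk⇔ (s<s ∘ Equivalence.to IH ∘ s<s⁻¹) (s<s ∘ Equivalence.from IH ∘ s<s⁻¹)
  where
  IH : punchIn k j < k ⇔ j < k
  IH = punchInₖ-<-⇔ k j

𝟙-embed-<-embed : ∀ (k : Fin (suc m)) i j → 𝟙 (embed k i <? embed k j) ≡ 𝟙 (i <? j)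
𝟙-embed-<-embed k i j = trans (𝟙-suc-<-suc (punchIn k i) (punchIn k j))
                              (𝟙-cong (punchIn k i <? punchIn k j) (i <? j) (punchIn-<-⇔ k))

𝟙-embed-<-suc : ∀ (k : Fin (suc m)) j → 𝟙 (embed k j <? suc k) ≡ 𝟙 (j <? k)
𝟙-embed-<-suc k j = trans (𝟙-suc-<-suc (punchIn k j) k) (𝟙-cong (punchIn k j <? k) (j <? k) (punchInₖ-<-⇔ k j))

count-< : ∀ (k : Fin (suc m)) → ∑[ j < m ] 𝟙 (j <? k) ≡ toℕ k
count-< {zero}  zero    = refl
count-< {suc m} zero    = ∑-zero (allFin (suc m)) (𝟙-<-zero {n = suc m})
count-< {suc m} (suc k) = trans (∑<-suc m (λ j → 𝟙 (j <? suc k)))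
  (cong₂ _+_ (𝟙-zero-<-suc {m = m} k) (trans (∑-cong (allFin m) (λ j → 𝟙-suc-<-suc j k)) (count-< k)))

∑<-odd : ∀ n → ∑[ k < n ] suc (toℕ k + toℕ k) ≡ n * n
∑<-odd zero    = refl
∑<-odd (suc n) = begin
  ∑[ k < suc n ] suc (toℕ k + toℕ k)                  ≡⟨ ∑<-suc n (λ k → suc (toℕ k + toℕ k)) ⟩
  1 + ∑[ k < n ] suc (suc (toℕ k) + suc (toℕ k))      ≡⟨ cong suc (∑-cong (allFin n) (λ k → shift (toℕ k))) ⟩
  1 + ∑[ k < n ] (suc (toℕ k + toℕ k) + 2)            ≡⟨ cong suc (∑-distrib-+ (allFin n) _ (λ _ → 2)) ⟩
  1 + (∑[ k < n ] suc (toℕ k + toℕ k) + ∑[ k < n ] 2) ≡⟨ cong suc (cong₂ _+_ (∑<-odd n) (∑<-const n 2)) ⟩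
  1 + (n * n + n * 2)                                 ≡⟨ square n ⟩
  suc n * suc n                                       ∎
  where
  open ≡-Reasoning
  shift : ∀ a → suc (suc a + suc a) ≡ suc (a + a) + 2
  shift = solve-∀
  square : ∀ n → 1 + (n * n + n * 2) ≡ suc n * suc n
  square = solve-∀

𝟙-inversion : Endo n → Fin n → Fin n → ℕ
𝟙-inversion π i j = 𝟙 (i <? j) * 𝟙 (π j <? π i)

inv-∑ : ∀ (π : Endo n) → inv π ≡ ∑[ i < n ] ∑[ j < n ] 𝟙-inversion π i j
inv-∑ {n} π = begin
  inv π                                                    ≡⟨ length≡∑1 (filter D pairs) ⟩
  ∑[ p ∈ filter D pairs ] 1                                ≡⟨ ∑-filter D pairs (λ _ → 1) ⟩
  ∑[ p ∈ pairs ] (𝟙 (D p) * 1)                             ≡⟨ ∑-concatMap _ (allFin n) (λ p → 𝟙 (D p) * 1) ⟩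
  ∑[ i < n ] ∑[ p ∈ map (i ,_) (allFin n) ] (𝟙 (D p) * 1)
    ≡⟨ ∑-cong (allFin n) (λ i → trans (∑-map (i ,_) (allFin n) _) (∑-cong (allFin n) (λ j →
         trans (*-identityʳ _) (𝟙-× (i <? j) (π j <? π i))))) ⟩
  ∑[ i < n ] ∑[ j < n ] 𝟙-inversion π i j                  ∎
  where
  open ≡-Reasoning
  D : ∀ (p : Fin n × Fin n) → Dec (proj₁ p < proj₂ p × π (proj₂ p) < π (proj₁ p))
  D p = (proj₁ p <? proj₂ p) ×-dec (π (proj₂ p) <? π (proj₁ p))
  pairs : List (Fin n × Fin n)
  pairs = concatMap (λ i → map (i ,_) (allFin n)) (allFin n)

inv-cong : Invariant (inv {n})
inv-cong {n} {π} {τ} π≗τ = begin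
  inv π                                    ≡⟨ inv-∑ π ⟩
  ∑[ i < n ] ∑[ j < n ] 𝟙-inversion π i j  ≡⟨ ∑-cong (allFin n) (λ i → ∑-cong (allFin n) (λ j →
                                                cong (𝟙 (i <? j) *_) (𝟙-<-cong (π≗τ j) (π≗τ i)))) ⟩
  ∑[ i < n ] ∑[ j < n ] 𝟙-inversion τ i j  ≡⟨ inv-∑ τ ⟨
  inv τ                                    ∎
  where open ≡-Reasoning

inv-lift₀ : ∀ (σ : Endo n) → inv (lift₀ σ) ≡ inv σ
inv-lift₀ {n} σ = begin
  inv (lift₀ σ)
    ≡⟨ inv-∑ (lift₀ σ) ⟩
  ∑[ i < suc n ] ∑[ j < suc n ] T i j
    ≡⟨ ∑<-suc n (λ i → ∑[ j < suc n ] T i j) ⟩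
  ∑[ j < suc n ] T zero j + ∑[ i < n ] ∑[ j < suc n ] T (suc i) j
    ≡⟨ cong₂ _+_ (∑-zero (allFin (suc n)) row-zero) (∑-cong (allFin n) row-suc) ⟩
  ∑[ i < n ] ∑[ j < n ] 𝟙-inversion σ i j
    ≡⟨ inv-∑ σ ⟨
  inv σ ∎
  where
  open ≡-Reasoning
  T : Fin (suc n) → Fin (suc n) → ℕ
  T = 𝟙-inversion (lift₀ σ)
  row-zero : ∀ j → T zero j ≡ 0
  row-zero j = trans (cong (𝟙 (zero {n} <? j) *_) (𝟙-<-zero {n = n} (lift₀ σ j)))
                     (*-zeroʳ (𝟙 (zero {n} <? j)))
  row-suc : ∀ i → ∑[ j < suc n ] T (suc i) j ≡ ∑[ j < n ] 𝟙-inversion σ i j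
  row-suc i = trans (∑<-suc n (T (suc i)))
    (cong₂ _+_ (cong (_* 𝟙 (zero {n} <? suc (σ i))) (𝟙-<-zero {n = n} (suc i)))
               (∑-cong (allFin n) (λ j → cong₂ _*_ (𝟙-suc-<-suc i j) (𝟙-suc-<-suc (σ j) (σ i)))))

∑<-by-position : ∀ (k : Fin (suc m)) (h : Fin (suc (suc m)) → ℕ) →
                 ∑[ i < suc (suc m) ] h i ≡ h zero + (h (suc k) + ∑[ j < m ] h (embed k j))
∑<-by-position {m} k h = trans (∑<-suc (suc m) h) (cong (h zero +_) (∑<-punchIn k (h ∘ suc)))

inv-pair₀ : ∀ (k : Fin (suc m)) σ → IsInvolution σ → inv (pair₀ k σ) ≡ suc (toℕ k + toℕ k) + inv σ
inv-pair₀ {m} k σ σσ≗id = begin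
  inv π
    ≡⟨ inv-∑ π ⟩
  ∑[ i < suc (suc m) ] row i
    ≡⟨ ∑<-by-position k row ⟩
  row zero + (row (suc k) + ∑[ i < m ] row (embed k i))
    ≡⟨ cong₂ _+_ row-zero (cong₂ _+_ row-pair (∑-cong (allFin m) row-embed)) ⟩
  suc (toℕ k) + (0 + ∑[ i < m ] (𝟙 (i <? k) + ∑[ j < m ] 𝟙-inversion σ i j))
    ≡⟨ cong (suc (toℕ k) +_) (∑-distrib-+ (allFin m) (λ i → 𝟙 (i <? k)) _) ⟩
  suc (toℕ k) + (∑[ i < m ] 𝟙 (i <? k) + ∑[ i < m ] ∑[ j < m ] 𝟙-inversion σ i j)
    ≡⟨ cong₂ (λ a b → suc (toℕ k) + (a + b)) (count-< k) (sym (inv-∑ σ)) ⟩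
  suc (toℕ k) + (toℕ k + inv σ)
    ≡⟨ cong suc (+-assoc (toℕ k) (toℕ k) (inv σ)) ⟨
  suc (toℕ k + toℕ k) + inv σ ∎
  where
  open ≡-Reasoning
  π : Endo (suc (suc m))
  π = pair₀ k σ
  T : Fin (suc (suc m)) → Fin (suc (suc m)) → ℕ
  T = 𝟙-inversion π
  row : Fin (suc (suc m)) → ℕ
  row i = ∑[ j < suc (suc m) ] T i j

  row-zero : row zero ≡ suc (toℕ k)
  row-zero = begin
    row zero
      ≡⟨ ∑<-by-position k (T zero) ⟩
    T zero zero + (T zero (suc k) + ∑[ j < m ] T zero (embed k j))
      ≡⟨ cong₂ _+_ (cong (_* 𝟙 (suc k <? suc k)) (𝟙-<-zero {n = suc m} (zero {suc m})))
                   (cong₂ _+_ T-zero-pair (∑-cong (allFin m) T-zero-embed)) ⟩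
    1 + ∑[ j < m ] 𝟙 (σ j <? k)
      ≡⟨ cong suc (∑<-reindex-involution σ σσ≗id (λ j → 𝟙 (j <? k))) ⟩
    1 + ∑[ j < m ] 𝟙 (j <? k)
      ≡⟨ cong suc (count-< k) ⟩
    suc (toℕ k) ∎
    where
    T-zero-pair : T zero (suc k) ≡ 1
    T-zero-pair = cong₂ _*_ (𝟙-zero-<-suc {m = suc m} k)
                            (trans (𝟙-<-cong {j = suc k} (pair₀-pair k σ) refl) (𝟙-zero-<-suc {m = suc m} k))
    T-zero-embed : ∀ j → T zero (embed k j) ≡ 𝟙 (σ j <? k)
    T-zero-embed j = trans
      (cong₂ _*_ (𝟙-zero-<-suc {m = suc m} (punchIn k j))
                 (trans (𝟙-<-cong {j = suc k} (pair₀-embed k σ j) refl) (𝟙-embed-<-suc k (σ j))))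
      (*-identityˡ (𝟙 (σ j <? k)))

  row-pair : row (suc k) ≡ 0
  row-pair = ∑-zero (allFin (suc (suc m))) λ j → trans
    (cong (𝟙 (suc k <? j) *_)
          (trans (𝟙-<-cong {i = π j} refl (pair₀-pair k σ)) (𝟙-<-zero {n = suc m} (π j))))
    (*-zeroʳ (𝟙 (suc k <? j)))

  row-embed : ∀ i → row (embed k i) ≡ 𝟙 (i <? k) + ∑[ j < m ] 𝟙-inversion σ i j
  row-embed i = trans (∑<-by-position k (T (embed k i)))
    (cong₂ _+_ T-embed-zero (cong₂ _+_ T-embed-pair (∑-cong (allFin m) T-embed-embed)))
    where
    T-embed-zero : T (embed k i) zero ≡ 0
    T-embed-zero = cong (_* 𝟙 (π zero <? π (embed k i))) (𝟙-<-zero {n = suc m} (embed k i))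
    T-embed-pair : T (embed k i) (suc k) ≡ 𝟙 (i <? k)
    T-embed-pair = trans
      (cong₂ _*_ (𝟙-embed-<-suc k i)
                 (trans (𝟙-<-cong (pair₀-pair k σ) (pair₀-embed k σ i))
                        (𝟙-zero-<-suc {m = suc m} (punchIn k (σ i)))))
      (*-identityʳ (𝟙 (i <? k)))
    T-embed-embed : ∀ j → T (embed k i) (embed k j) ≡ 𝟙-inversion σ i j
    T-embed-embed j = cong₂ _*_ (𝟙-embed-<-embed k i j)
      (trans (𝟙-<-cong (pair₀-embed k σ j) (pair₀-embed k σ i)) (𝟙-embed-<-embed k (σ j) (σ i)))

r1-suc-suc : ∀ m → r1 (suc (suc m)) ≡ r1 (suc m) + suc m * r1 m
r1-suc-suc m = begin
  r1 (suc (suc m))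
    ≡⟨ length≡∑1 (involutions (suc (suc m))) ⟩
  ∑[ π ∈ involutions (suc (suc m)) ] 1
    ≡⟨ ∑-involutions-suc-suc m (λ _ → 1) (λ _ → refl) ⟩
  ∑[ σ ∈ involutions (suc m) ] 1 + ∑[ k < suc m ] ∑[ σ ∈ involutions m ] 1
    ≡⟨ cong₂ _+_ (length≡∑1 (involutions (suc m)))
                 (∑-cong (allFin (suc m)) (λ _ → length≡∑1 (involutions m))) ⟨
  r1 (suc m) + ∑[ k < suc m ] r1 m
    ≡⟨ cong (r1 (suc m) +_) (∑<-const (suc m) (r1 m)) ⟩
  r1 (suc m) + suc m * r1 m ∎
  where open ≡-Reasoning

i1-suc-suc : ∀ m → i1 (suc (suc m)) ≡ i1 (suc m) + suc m * i1 m + suc m * suc m * r1 m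
i1-suc-suc m = begin
  i1 (suc (suc m))
    ≡⟨ ∑-involutions-suc-suc m inv inv-cong ⟩
  ∑[ σ ∈ involutions (suc m) ] inv (lift₀ σ) + ∑[ k < suc m ] ∑[ σ ∈ involutions m ] inv (pair₀ k σ)
    ≡⟨ cong₂ _+_ (∑-cong (involutions (suc m)) inv-lift₀) (∑-cong (allFin (suc m)) pair₀-sum) ⟩
  i1 (suc m) + ∑[ k < suc m ] (r1 m * odd k + i1 m)
    ≡⟨ cong (i1 (suc m) +_) (∑-distrib-+ (allFin (suc m)) (λ k → r1 m * odd k) (λ _ → i1 m)) ⟩
  i1 (suc m) + (∑[ k < suc m ] (r1 m * odd k) + ∑[ k < suc m ] i1 m)
    ≡⟨ cong (i1 (suc m) +_) (cong₂ _+_ (sym (*-distribˡ-∑ (r1 m) (allFin (suc m)) odd))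
                                       (∑<-const (suc m) (i1 m))) ⟩
  i1 (suc m) + (r1 m * ∑[ k < suc m ] odd k + suc m * i1 m)
    ≡⟨ cong (λ s → i1 (suc m) + (r1 m * s + suc m * i1 m)) (∑<-odd (suc m)) ⟩
  i1 (suc m) + (r1 m * (suc m * suc m) + suc m * i1 m)
    ≡⟨ rearrange (i1 (suc m)) (r1 m) (suc m) (i1 m) ⟩
  i1 (suc m) + suc m * i1 m + suc m * suc m * r1 m ∎
  where
  open ≡-Reasoning
  odd : Fin (suc m) → ℕ
  odd k = suc (toℕ k + toℕ k)
  pair₀-sum : ∀ k → ∑[ σ ∈ involutions m ] inv (pair₀ k σ) ≡ r1 m * odd k + i1 m
  pair₀-sum k = begin
    ∑[ σ ∈ involutions m ] inv (pair₀ k σ)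
      ≡⟨ ∑-filter-cong isInvolution? (allFuns m m) (inv-pair₀ k) ⟩
    ∑[ σ ∈ involutions m ] (odd k + inv σ)
      ≡⟨ ∑-distrib-+ (involutions m) (λ _ → odd k) inv ⟩
    ∑[ σ ∈ involutions m ] odd k + i1 m
      ≡⟨ cong (_+ i1 m) (∑-const (involutions m) (odd k)) ⟩
    r1 m * odd k + i1 m ∎
  rearrange : ∀ i r n j → i + (r * (n * n) + n * j) ≡ i + n * j + n * n * r
  rearrange = solve-∀

-- The closed form

nC0≡1 : ∀ n → n C 0 ≡ 1
nC0≡1 n = trans (nCk≡nC[n∸k] {0} {n} z≤n) (nCn≡1 n)

[k+1]*[n+1]C[k+1]≡[n+1]*nCk : ∀ n k → suc k * (suc n C suc k) ≡ suc n * (n C k)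
[k+1]*[n+1]C[k+1]≡[n+1]*nCk n zero = begin
  1 * (suc n C 1)  ≡⟨ *-identityˡ (suc n C 1) ⟩
  suc n C 1        ≡⟨ nC1≡n (suc n) ⟩
  suc n            ≡⟨ *-identityʳ (suc n) ⟨
  suc n * 1        ≡⟨ cong (suc n *_) (nC0≡1 n) ⟨
  suc n * (n C 0)  ∎
  where open ≡-Reasoning
[k+1]*[n+1]C[k+1]≡[n+1]*nCk zero (suc k) = begin
  suc (suc k) * (1 C suc (suc k))  ≡⟨ cong (suc (suc k) *_) (k>n⇒nCk≡0 {1} {suc (suc k)} (s<s z<s)) ⟩
  suc (suc k) * 0                  ≡⟨ *-zeroʳ (suc (suc k)) ⟩
  0                                ≡⟨ cong (1 *_) (k>n⇒nCk≡0 {0} {suc k} z<s) ⟨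
  1 * (0 C suc k)                  ∎
  where open ≡-Reasoning
[k+1]*[n+1]C[k+1]≡[n+1]*nCk (suc n) (suc k) = begin
  suc (suc k) * (suc (suc n) C suc (suc k))
    ≡⟨ cong (suc (suc k) *_) (nCk+nC[k+1]≡[n+1]C[k+1] (suc n) (suc k)) ⟨
  suc (suc k) * (suc n C suc k + suc n C suc (suc k))
    ≡⟨ *-distribˡ-+ (suc (suc k)) (suc n C suc k) _ ⟩
  suc n C suc k + suc k * (suc n C suc k) + suc (suc k) * (suc n C suc (suc k))
    ≡⟨ cong₂ (λ a b → suc n C suc k + a + b) ([k+1]*[n+1]C[k+1]≡[n+1]*nCk n k)
                                              ([k+1]*[n+1]C[k+1]≡[n+1]*nCk n (suc k)) ⟩
  suc n C suc k + suc n * (n C k) + suc n * (n C suc k)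
    ≡⟨ +-assoc (suc n C suc k) _ _ ⟩
  suc n C suc k + (suc n * (n C k) + suc n * (n C suc k))
    ≡⟨ cong (suc n C suc k +_) (*-distribˡ-+ (suc n) (n C k) (n C suc k)) ⟨
  suc n C suc k + suc n * (n C k + n C suc k)
    ≡⟨ cong (λ c → suc n C suc k + suc n * c) (nCk+nC[k+1]≡[n+1]C[k+1] n k) ⟩
  suc (suc n) * (suc n C suc k) ∎
  where open ≡-Reasoning

2*[x+2]C2 : ∀ x → 2 * ((2 + x) C 2) ≡ (2 + x) * (1 + x)
2*[x+2]C2 x = trans ([k+1]*[n+1]C[k+1]≡[n+1]*nCk (1 + x) 1) (cong ((2 + x) *_) (nC1≡n (1 + x)))

6*[x+3]C3 : ∀ x → 6 * ((3 + x) C 3) ≡ (3 + x) * (2 + x) * (1 + x)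
6*[x+3]C3 x = begin
  6 * ((3 + x) C 3)              ≡⟨ *-assoc 2 3 ((3 + x) C 3) ⟩
  2 * (3 * ((3 + x) C 3))        ≡⟨ cong (2 *_) ([k+1]*[n+1]C[k+1]≡[n+1]*nCk (2 + x) 2) ⟩
  2 * ((3 + x) * ((2 + x) C 2))  ≡⟨ *.x∙yz≈y∙xz 2 (3 + x) ((2 + x) C 2) ⟩
  (3 + x) * (2 * ((2 + x) C 2))  ≡⟨ cong ((3 + x) *_) (2*[x+2]C2 x) ⟩
  (3 + x) * ((2 + x) * (1 + x))  ≡⟨ *-assoc (3 + x) (2 + x) (1 + x) ⟨
  (3 + x) * (2 + x) * (1 + x)    ∎
  where open ≡-Reasoning

24*[x+4]C4 : ∀ x → 24 * ((4 + x) C 4) ≡ (4 + x) * (3 + x) * (2 + x) * (1 + x)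
24*[x+4]C4 x = begin
  24 * ((4 + x) C 4)                       ≡⟨ *-assoc 6 4 ((4 + x) C 4) ⟩
  6 * (4 * ((4 + x) C 4))                  ≡⟨ cong (6 *_) ([k+1]*[n+1]C[k+1]≡[n+1]*nCk (3 + x) 3) ⟩
  6 * ((4 + x) * ((3 + x) C 3))            ≡⟨ *.x∙yz≈y∙xz 6 (4 + x) ((3 + x) C 3) ⟩
  (4 + x) * (6 * ((3 + x) C 3))            ≡⟨ cong ((4 + x) *_) (6*[x+3]C3 x) ⟩
  (4 + x) * ((3 + x) * (2 + x) * (1 + x))  ≡⟨ reassociate (4 + x) (3 + x) (2 + x) (1 + x) ⟩
  (4 + x) * (3 + x) * (2 + x) * (1 + x)    ∎
  where
  open ≡-Reasoning
  reassociate : ∀ a b c d → a * (b * c * d) ≡ a * b * c * d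
  reassociate = solve-∀

closedForm : ℕ → ℕ
closedForm n = (n C 2) * r1-sub n 2 + 2 * (n C 3) * r1-sub n 3 + 6 * (n C 4) * r1-sub n 4

Φ : ℕ → ℕ → ℕ → ℕ → ℕ
Φ x r₂ r₁ r₀ = 12 * ((4 + x) * (3 + x)) * r₂ + 8 * ((4 + x) * (3 + x) * (2 + x)) * r₁
             + 6 * ((4 + x) * (3 + x) * (2 + x) * (1 + x)) * r₀

24*closedForm : ∀ x → 24 * closedForm (4 + x) ≡ Φ x (r1 (2 + x)) (r1 (1 + x)) (r1 x)
24*closedForm x = begin
  24 * closedForm (4 + x)
    ≡⟨ distribute ((4 + x) C 2) ((4 + x) C 3) ((4 + x) C 4) (r1 (2 + x)) (r1 (1 + x)) (r1 x) ⟩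
  12 * (2 * ((4 + x) C 2)) * r1 (2 + x) + 8 * (6 * ((4 + x) C 3)) * r1 (1 + x)
    + 6 * (24 * ((4 + x) C 4)) * r1 x
    ≡⟨ cong₂ _+_ (cong₂ _+_ (cong (λ c → 12 * c * r1 (2 + x)) (2*[x+2]C2 (2 + x)))
                            (cong (λ c → 8 * c * r1 (1 + x)) (6*[x+3]C3 (1 + x))))
                 (cong (λ c → 6 * c * r1 x) (24*[x+4]C4 x)) ⟩
  Φ x (r1 (2 + x)) (r1 (1 + x)) (r1 x) ∎
  where
  open ≡-Reasoning
  distribute : ∀ c₂ c₃ c₄ r₂ r₁ r₀ →
    24 * (c₂ * r₂ + 2 * c₃ * r₁ + 6 * c₄ * r₀) ≡
    12 * (2 * c₂) * r₂ + 8 * (6 * c₃) * r₁ + 6 * (24 * c₄) * r₀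
  distribute = solve-∀

Φ-suc-suc : ∀ k a b c d e → c ≡ b + (1 + k) * a → d ≡ c + (2 + k) * b → e ≡ d + (3 + k) * c →
            Φ (2 + k) e d c ≡ Φ (1 + k) d c b + (5 + k) * Φ k c b a + 24 * ((5 + k) * (5 + k) * e)
Φ-suc-suc k a b _ _ _ refl refl refl = identity k a b
  where
  -- Φ is repeated as a let because the ring solver does not unfold definitions.
  identity : ∀ k a b →
    let Φ′ = λ x r₂ r₁ r₀ → 12 * ((4 + x) * (3 + x)) * r₂ + 8 * ((4 + x) * (3 + x) * (2 + x)) * r₁
                          + 6 * ((4 + x) * (3 + x) * (2 + x) * (1 + x)) * r₀
        c = b + (1 + k) * a
        d = c + (2 + k) * b
        e = d + (3 + k) * c
    in Φ′ (2 + k) e d c ≡ Φ′ (1 + k) d c b + (5 + k) * Φ′ k c b a + 24 * ((5 + k) * (5 + k) * e)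
  identity = solve-∀

closedForm-suc-suc : ∀ m →
  closedForm (suc (suc m)) ≡ closedForm (suc m) + suc m * closedForm m + suc m * suc m * r1 m
-- 24 * closedForm n is given by Φ only for n ≥ 4 (r1-sub truncates below), so the cases
-- involving closedForm m with m < 4 are evaluated.
closedForm-suc-suc 0 = refl
closedForm-suc-suc 1 = refl
closedForm-suc-suc 2 = refl
closedForm-suc-suc 3 = refl
closedForm-suc-suc (suc (suc (suc (suc k)))) = *-cancelˡ-≡ _ _ 24 (begin
  24 * closedForm (6 + k)
    ≡⟨ 24*closedForm (2 + k) ⟩
  Φ (2 + k) (r1 (4 + k)) (r1 (3 + k)) (r1 (2 + k))
    ≡⟨ Φ-suc-suc k (r1 k) (r1 (1 + k)) _ _ _ (r1-suc-suc k) (r1-suc-suc (1 + k)) (r1-suc-suc (2 + k)) ⟩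
  Φ (1 + k) (r1 (3 + k)) (r1 (2 + k)) (r1 (1 + k)) + (5 + k) * Φ k (r1 (2 + k)) (r1 (1 + k)) (r1 k) + 24 * R
    ≡⟨ cong₂ (λ A B → A + (5 + k) * B + 24 * R) (24*closedForm (1 + k)) (24*closedForm k) ⟨
  24 * closedForm (5 + k) + (5 + k) * (24 * closedForm (4 + k)) + 24 * R
    ≡⟨ factor (closedForm (5 + k)) (closedForm (4 + k)) R (5 + k) ⟩
  24 * (closedForm (5 + k) + (5 + k) * closedForm (4 + k) + R) ∎)
  where
  open ≡-Reasoning
  R : ℕ
  R = (5 + k) * (5 + k) * r1 (4 + k)
  factor : ∀ A B C c → 24 * A + c * (24 * B) + 24 * C ≡ 24 * (A + c * B + C)
  factor = solve-∀

theorem5p2 : (n : ℕ) →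
    i1 n ≡ (n C 2) * r1-sub n 2 + 2 * (n C 3) * r1-sub n 3 + 6 * (n C 4) * r1-sub n 4
theorem5p2 0 = refl
theorem5p2 1 = refl
theorem5p2 (suc (suc m)) = begin
  i1 (suc (suc m))
    ≡⟨ i1-suc-suc m ⟩
  i1 (suc m) + suc m * i1 m + suc m * suc m * r1 m
    ≡⟨ cong₂ (λ a b → a + suc m * b + suc m * suc m * r1 m) (theorem5p2 (suc m)) (theorem5p2 m) ⟩
  closedForm (suc m) + suc m * closedForm m + suc m * suc m * r1 m
    ≡⟨ closedForm-suc-suc m ⟨
  closedForm (suc (suc m)) ∎
  where open ≡-Reasoning
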